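{- Let $U$ be a regular subgroup of $G$ and $C$ a decisive, $U$-symmetric social preference correspondence. Then the following are equivalent: (i) $C$ admits a $U$-symmetric resolute refinement; (ii) there exists an irreflexive, acyclic, $U$-symmetric social method $R$ such that $C^R$ refines $C$; (iii) there exists an irreflexive, acyclic social method $R$ such that $C^R$ refines $C$ and, for every $p\in\mathcal P$, $x,y\in N$ and $(\varphi,\psi,\rho_0)\in\mathrm{Stab}_U(p)$, we have $(x,y)\in R(p)$ if and only if $(\psi(y),\psi(x))\in R(p)$.
   Context: Let $n,h\ge 2$ be integers, $N=\{1,\dots,n\}$, $H=\{1,\dots,h\}$. $S_m$ is the symmetric group on $\{1,\dots,m\}$ with product $(\sigma\tau)(x)=\sigma(\tau(x))$. $\mathbf L(N)$ is the set of linear orders on $N$; a linear order $q$ with $q(1)\succ\dots\succ q(n)$ is identified with the permutation $r\mapsto q(r)$ in $S_n$. Let $\rho_0(r)=n-r+1$, $\Omega=\{id,\rho_0\}\le S_n$. For $\sigma\in S_n$ and a relation $A\subseteq N^2$: $\sigma A=\{(\sigma(x),\sigma(y)):(x,y)\in A\}$, $A\,id=A$, $A\rho_0=\{(y,x):(x,y)\in A\}$, extended elementwise to sets of relations (for linear orders this agrees with permutation products). $\mathcal P=\mathbf L(N)^h$. $G=S_h\times S_n\times\Omega$ (componentwise product); $p^{(\varphi,\psi,\rho)}$ is the profile with $i$-th component $\psi p_{\varphi^{ -1}(i)}\rho$; $\mathrm{Stab}_U(p)=\{g\in U:p^g=p\}$. $U\le G$ is regular if for every $p\in\mathcal P$ there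 is $\psi_*\in S_n$ conjugate to $\rho_0$ with $\mathrm{Stab}_U(p)\subseteq(S_h\times\{id\}\times\{id\})\cup(S_h\times\{\psi_*\}\times\{\rho_0\})$. A social preference correspondence (SPC) assigns to each $p$ a subset $C(p)\subseteq\mathbf L(N)$; decisive: $C(p)\ne\emptyset$ always; resolute: $|C(p)|=1$ always; $C'$ refines $C$ if $C'(p)\subseteq C(p)$ for all $p$. $C$ is $U$-symmetric if $C(p^{(\varphi,\psi,\rho)})=\psi C(p)\rho$ for all $p$ and $(\varphi,\psi,\rho)\in U$. A social method is a function $R$ from $\mathcal P$ to relations on $N$; it is irreflexive/acyclic if each $R(p)$ is (acyclic: for every sequence $x_1,\dots,x_s$, $s\ge2$, of distinct elements with $(x_i,x_{i+1})\in R(p)$, $(x_s,x_1)\notin R(p)$); it is $U$-symmetric if $R(p^{(\varphi,\psi,\rho)})=\psi R(p)\rho$ for all $p$ and $(\varphi,\psi,\rho)\in U$. $C^R$ is the SPC $C^R(p)=\{q\in\mathbf L(N):R(p)\subseteq q\}$. -}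

module Defs where

open import Data.Nat.Base using (ℕ)
open import Data.Bool.Base using (Bool; T)
open import Data.Fin.Base using (Fin; _<_)
open import Data.Fin.Permutation as P
  using (Permutation′; _⟨$⟩ʳ_; _⟨$⟩ˡ_; _∘ₚ_; flip; reverse)
open import Data.List.Base using (List; _∷_; _++_; [_])
open import Data.List.Relation.Unary.Unique.Propositional using (Unique)
open import Data.List.Relation.Unary.Linked using (Linked)
open import Data.Product.Base using (Σ; ∃; ∃₂; _×_; _,_)
open import Data.Sum.Base using (_⊎_)
open import Relation.Binary.PropositionalEquality using (_≡_)
open import Relation.Nullary using (¬_)
open import Function.Bundles using (_⇔_)
open import Level using (Level; suc; zero)

-- Permutations (S_m), with  σ · τ = σ ∘ τ  (apply τ first)

Perm : ℕ → Set
Perm m = Permutation′ m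

infixl 7 _·_
_·_ : ∀ {m} → Perm m → Perm m → Perm m
σ · τ = τ ∘ₚ σ

idP : ∀ {m} → Perm m
idP = P.id

_⁻¹ : ∀ {m} → Perm m → Perm m
σ ⁻¹ = flip σ

_≈ₚ_ : ∀ {m} → Perm m → Perm m → Set
σ ≈ₚ τ = σ P.≈ τ

-- Ω = {id, ρ₀};  ρ₀ is the order-reversing permutation r ↦ n - r + 1
-- (0-indexed: Data.Fin.opposite).

data Ω : Set where
  ι ρ₀ : Ω

_·Ω_ : Ω → Ω → Ω
ι ·Ω x = x
ρ₀ ·Ω ι = ρ₀
ρ₀ ·Ω ρ₀ = ι

⟦_⟧Ω : ∀ {n} → Ω → Perm n
⟦ ι ⟧Ω = idP
⟦ ρ₀ ⟧Ω = reverse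

-- Linear orders on N = Fin n, identified with permutations q
-- (rank r ↦ q(r), rank 0 is the top).  As a (strict) relation:
-- (x , y) ∈ q  iff  x ≻_q y  iff  rank of x < rank of y.

LinOrd : ℕ → Set
LinOrd n = Perm n

ordRel : ∀ {n} → LinOrd n → Fin n → Fin n → Set
ordRel q x y = (q ⟨$⟩ˡ x) < (q ⟨$⟩ˡ y)

Profile : ℕ → ℕ → Set
Profile h n = Fin h → LinOrd n

_≈P_ : ∀ {h n} → Profile h n → Profile h n → Set
p ≈P p′ = ∀ i → p i ≈ₚ p′ i

record G (h n : ℕ) : Set where
  constructor ⟨_,_,_⟩
  field
    φ : Perm h
    ψ : Perm n
    ρ : Ω
open G public

_≈G_ : ∀ {h n} → G h n → G h n → Set
g ≈G g′ = (φ g ≈ₚ φ g′) × (ψ g ≈ₚ ψ g′) × (ρ g ≡ ρ g′)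

_·G_ : ∀ {h n} → G h n → G h n → G h n
g ·G g′ = ⟨ φ g · φ g′ , ψ g · ψ g′ , ρ g ·Ω ρ g′ ⟩

1G : ∀ {h n} → G h n
1G = ⟨ idP , idP , ι ⟩

invG : ∀ {h n} → G h n → G h n
invG g = ⟨ φ g ⁻¹ , ψ g ⁻¹ , ρ g ⟩

act : ∀ {h n} → Profile h n → G h n → Profile h n
act p g i = ψ g · p (φ g ⟨$⟩ˡ i) · ⟦ ρ g ⟧Ω

-- Subgroups of G, represented by a (decidable) membership predicate,
-- invariant under equality of group elements.

_∈ᵤ_ : ∀ {h n} → G h n → (G h n → Bool) → Set
g ∈ᵤ U = T (U g)

record IsSubgroup {h n} (U : G h n → Bool) : Set where
  field
    resp  : ∀ {g g′} → g ≈G g′ → g ∈ᵤ U → g′ ∈ᵤ U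
    one   : 1G ∈ᵤ U
    mul   : ∀ {g g′} → g ∈ᵤ U → g′ ∈ᵤ U → (g ·G g′) ∈ᵤ U
    inv   : ∀ {g} → g ∈ᵤ U → invG g ∈ᵤ U

InStab : ∀ {h n} → (G h n → Bool) → Profile h n → G h n → Set
InStab U p g = g ∈ᵤ U × act p g ≈P p

ConjugateToρ₀ : ∀ {n} → Perm n → Set
ConjugateToρ₀ {n} ψ* = Σ (Perm n) λ τ → ψ* ≈ₚ (τ · reverse · τ ⁻¹)

Regular : ∀ {h n} → (G h n → Bool) → Set
Regular {h} {n} U =
  ∀ (p : Profile h n) → Σ (Perm n) λ ψ* → ConjugateToρ₀ ψ* ×
    (∀ g → InStab U p g →
       ((ψ g ≈ₚ idP) × (ρ g ≡ ι)) ⊎ ((ψ g ≈ₚ ψ*) × (ρ g ≡ ρ₀)))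

-- Social preference correspondences: C(p) ⊆ L(N), given by a
-- (decidable) membership predicate, well defined on equality classes.

record SPC (h n : ℕ) : Set where
  field
    mem  : Profile h n → LinOrd n → Bool
    resp : ∀ {p p′ q q′} → p ≈P p′ → q ≈ₚ q′ → T (mem p q) → T (mem p′ q′)
open SPC public

_∈C_ : ∀ {h n} → LinOrd n → Profile h n × SPC h n → Set
q ∈C (p , C) = T (mem C p q)

Decisive : ∀ {h n} → SPC h n → Set
Decisive {h} {n} C = ∀ (p : Profile h n) → Σ (LinOrd n) λ q → q ∈C (p , C)

Resolute : ∀ {h n} → SPC h n → Set
Resolute {h} {n} C = ∀ (p : Profile h n) → Σ (LinOrd n) λ q →
  q ∈C (p , C) × (∀ q′ → q′ ∈C (p , C) → q′ ≈ₚ q)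

RefinesP : ∀ {h n} → (Profile h n → LinOrd n → Set) → SPC h n → Set
RefinesP {h} {n} C′ C = ∀ (p : Profile h n) q → C′ p q → q ∈C (p , C)

Refines : ∀ {h n} → SPC h n → SPC h n → Set
Refines C′ C = RefinesP (λ p q → q ∈C (p , C′)) C

USymmetricSPC : ∀ {h n} → (G h n → Bool) → SPC h n → Set
USymmetricSPC {h} {n} U C = ∀ (p : Profile h n) g → g ∈ᵤ U → ∀ q →
  (q ∈C (act p g , C)) ⇔
  (Σ (LinOrd n) λ q′ → q′ ∈C (p , C) × q ≈ₚ (ψ g · q′ · ⟦ ρ g ⟧Ω))

Relation : ℕ → Set
Relation n = Fin n → Fin n → Bool

_∈R_ : ∀ {n} → Fin n × Fin n → Relation n → Set
(x , y) ∈R A = T (A x y)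

permRelSet : ∀ {n} → Perm n → Relation n → Fin n → Fin n → Set
permRelSet σ A x y = ∃₂ λ a b → (a , b) ∈R A × x ≡ σ ⟨$⟩ʳ a × y ≡ σ ⟨$⟩ʳ b

-- (σ A) ρ  with  B id = B,  B ρ₀ = converse of B
actRelSet : ∀ {n} → Perm n → Relation n → Ω → Fin n → Fin n → Set
actRelSet σ A ι  x y = permRelSet σ A x y
actRelSet σ A ρ₀ x y = permRelSet σ A y x

record SocialMethod (h n : ℕ) : Set where
  field
    rel  : Profile h n → Relation n
    resp : ∀ {p p′} → p ≈P p′ → ∀ x y → rel p x y ≡ rel p′ x y
open SocialMethod public

Irreflexive : ∀ {h n} → SocialMethod h n → Set
Irreflexive {h} {n} R = ∀ (p : Profile h n) (x : Fin n) → ¬ ((x , x) ∈R rel R p)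

Acyclic : ∀ {h n} → SocialMethod h n → Set
Acyclic {h} {n} R = ∀ (p : Profile h n) (x : Fin n) (ys : List (Fin n)) (z : Fin n) →
  Unique (x ∷ ys ++ [ z ]) →
  Linked (λ a b → (a , b) ∈R rel R p) (x ∷ ys ++ [ z ]) →
  ¬ ((z , x) ∈R rel R p)

USymmetricSM : ∀ {h n} → (G h n → Bool) → SocialMethod h n → Set
USymmetricSM {h} {n} U R = ∀ (p : Profile h n) g → g ∈ᵤ U → ∀ x y →
  ((x , y) ∈R rel R (act p g)) ⇔ actRelSet (ψ g) (rel R p) (ρ g) x y

CR : ∀ {h n} → SocialMethod h n → Profile h n → LinOrd n → Set
CR R p q = ∀ x y → (x , y) ∈R rel R p → ordRel q x y

Cond-i : ∀ {h n} → (G h n → Bool) → SPC h n → Set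
Cond-i {h} {n} U C = Σ (SPC h n) λ C′ →
  Resolute C′ × USymmetricSPC U C′ × Refines C′ C

Cond-ii : ∀ {h n} → (G h n → Bool) → SPC h n → Set
Cond-ii {h} {n} U C = Σ (SocialMethod h n) λ R →
  Irreflexive R × Acyclic R × USymmetricSM U R × RefinesP (CR R) C

Cond-iii : ∀ {h n} → (G h n → Bool) → SPC h n → Set
Cond-iii {h} {n} U C = Σ (SocialMethod h n) λ R →
  Irreflexive R × Acyclic R × RefinesP (CR R) C ×
  (∀ (p : Profile h n) (x y : Fin n) (φ′ : Perm h) (ψ′ : Perm n) →
     InStab U p ⟨ φ′ , ψ′ , ρ₀ ⟩ →
     ((x , y) ∈R rel R p) ⇔ ((ψ′ ⟨$⟩ʳ y , ψ′ ⟨$⟩ʳ x) ∈R rel R p))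

module Submission where

-- (i) ⇒ (ii): let R(p) be the unique order in C′(p); a linear order that
-- contains another one equals it, so C^R = C′.  (ii) ⇒ (iii): by regularity
-- the ψ of an element (φ, ψ, ρ₀) of Stab_U(p) is an involution, and
-- U-symmetry at that element says R(p) is reversed by ψ.  (iii) ⇒ (i): give
-- every profile r a linear extension of R(r) fixed by Stab_U(r) and transport
-- it from a canonical representative of each U-orbit to the whole orbit.  By
-- regularity Stab_U(r) acts on orders trivially or via q ↦ ψ* q ρ₀ with ψ* an
-- involution with at most one fixed point; then a self-dual extension is
-- built from the outside in.

open import Defs
open import Data.Nat.Base using (ℕ; zero; suc; _+_; _≤_; _<_; s≤s; z≤n)
open import Data.Nat.Properties using (+-suc; suc-injective; <-irrefl; <-asym; <-cmp; +-mono-<-≤; +-mono-≤-<; <-≤-trans; ≰⇒>; ≮⇒≥; _≤?_; _<?_; m+[n∸m]≡n; ≤-refl; <⇒≤; ≤-trans; m≤n+m; ≤-reflexive; ≤-pred; m≤n⇒m<n∨m≡n; n≤1+n; +-identityʳ; +-cancelʳ-≤; +-monoʳ-≤; ≤-<-trans; ≤-antisym; m≤m+n; +-cancelˡ-≤; +-mono-≤; <-trans)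
open import Data.Fin.Base using (Fin; toℕ; opposite; zero; suc; fromℕ<)
open import Data.Fin.Properties using (_≟_; all?; toℕ-injective; toℕ<n; opposite-prop; opposite-involutive; any?; toℕ-fromℕ<; injective⇒≤)
open import Data.Fin.Permutation using (_⟨$⟩ʳ_; _⟨$⟩ˡ_; inverseˡ; inverseʳ)
open import Data.Product.Base using (Σ; _×_; _,_; ∃; proj₁; proj₂)
open import Function.Base using (_∘_)
open import Relation.Binary.PropositionalEquality using (_≡_; refl; sym; trans; cong; subst; subst₂; module ≡-Reasoning; _≢_)
open import Relation.Nullary using (Dec; yes; no; contradiction; _×-dec_; ¬_; ¬?)
open import Data.Empty using (⊥-elim; ⊥)
open import Relation.Binary.Bundles using (Setoid)
open import Relation.Binary.Definitions using (tri<; tri≈; tri>)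
open import Level using (0ℓ)
import Data.Fin.Permutation as P
open import Data.List.Base using (List; []; _∷_; [_]; allFin; cartesianProduct; cartesianProductWith; _++_; length; lookup)
open import Data.List.Relation.Unary.Any as Any using (Any; here; there)
open import Data.List.Relation.Unary.Any.Properties using (cartesianProductWith⁺; cartesianProduct⁺)
open import Data.List.Membership.Propositional.Properties using (∈-allFin; ∈-∃++)
open import Relation.Unary using (Decidable)
open import Function.Bundles using (_⇔_; Equivalence; mk⇔)
open import Data.Bool.Base using (Bool; T)
open import Relation.Nullary.Decidable using (T?; isYes; toWitness; fromWitness; toSum; map′)
import Relation.Binary.Reasoning.Setoid as SetoidReasoning
import Data.Fin.Permutation.Components as PC
open import Data.List.Properties using (++-assoc)
open import Data.List.Relation.Unary.All using (All; []; _∷_)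
open import Data.List.Relation.Unary.All.Properties using (++⁻ˡ; ¬Any⇒All¬)
open import Data.List.Relation.Unary.Unique.Propositional using (Unique; []; _∷_)
open import Data.List.Relation.Unary.Linked using (Linked; []; [-]; _∷_)
open import Data.List.Membership.Propositional using (_∈_)
open import Data.Sum.Base using (_⊎_; inj₁; inj₂; [_,_]′)
import Function.Properties.Equivalence as ⇔

private variable
  A : Set
  m n : ℕ

-- Equality of permutations, wrapped in a record so that both sides can be
-- recovered by unification (the bare pointwise equation hides them).
infix 4 _≃_
record _≃_ {m} (σ τ : Perm m) : Set where
  constructor mk≃
  field app : σ ≈ₚ τ
open _≃_ public

≃-refl : {σ : Perm m} → σ ≃ σ
≃-refl = mk≃ λ _ → refl

≃-sym : {σ τ : Perm m} → σ ≃ τ → τ ≃ σ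
≃-sym (mk≃ e) = mk≃ λ i → sym (e i)

≃-trans : {σ τ υ : Perm m} → σ ≃ τ → τ ≃ υ → σ ≃ υ
≃-trans (mk≃ e) (mk≃ f) = mk≃ λ i → trans (e i) (f i)

≃-setoid : ℕ → Setoid 0ℓ 0ℓ
≃-setoid m = record
  { Carrier = Perm m ; _≈_ = _≃_
  ; isEquivalence = record { refl = ≃-refl ; sym = ≃-sym ; trans = ≃-trans } }

≃-inverse : {σ τ : Perm m} → σ ≃ τ → ∀ x → σ ⟨$⟩ˡ x ≡ τ ⟨$⟩ˡ x
≃-inverse {σ = σ} {τ} (mk≃ e) x =
  trans (sym (inverseˡ τ)) (cong (τ ⟨$⟩ˡ_) (trans (sym (e _)) (inverseʳ σ)))

_≃?_ : (σ τ : Perm m) → Dec (σ ≃ τ)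
σ ≃? τ with all? (λ i → σ ⟨$⟩ʳ i ≟ τ ⟨$⟩ʳ i)
... | yes e = yes (mk≃ e)
... | no ¬e = no λ e → ¬e (app e)

perm-injective : (π : Perm m) {a b : Fin m} → π ⟨$⟩ʳ a ≡ π ⟨$⟩ʳ b → a ≡ b
perm-injective π {a} {b} e = trans (sym (inverseˡ π)) (trans (cong (π ⟨$⟩ˡ_) e) (inverseˡ π))

⟦⟧Ω-hom : ∀ a b (x : Fin m) → ⟦ a ⟧Ω ⟨$⟩ʳ (⟦ b ⟧Ω ⟨$⟩ʳ x) ≡ ⟦ a ·Ω b ⟧Ω ⟨$⟩ʳ x
⟦⟧Ω-hom ι  b  x = refl
⟦⟧Ω-hom ρ₀ ι  x = refl
⟦⟧Ω-hom ρ₀ ρ₀ x = opposite-involutive x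

·Ω-comm : ∀ a b → a ·Ω b ≡ b ·Ω a
·Ω-comm ι  ι  = refl
·Ω-comm ι  ρ₀ = refl
·Ω-comm ρ₀ ι  = refl
·Ω-comm ρ₀ ρ₀ = refl

·Ω-self : ∀ a → a ·Ω a ≡ ι
·Ω-self ι  = refl
·Ω-self ρ₀ = refl

-- The reversal r ↦ n-1-r of ranks: ranks r and opposite r sum to n - 1,
-- so opposite is antitone and has at most one fixed point.
opposite-sum : (r : Fin m) → suc (toℕ r + toℕ (opposite r)) ≡ m
opposite-sum r = trans (cong (λ w → suc (toℕ r + w)) (opposite-prop r)) (m+[n∸m]≡n (toℕ<n r))

opposite-sums : (u v : Fin m) → toℕ u + toℕ (opposite u) ≡ toℕ v + toℕ (opposite v)
opposite-sums u v = suc-injective (trans (opposite-sum u) (sym (opposite-sum v)))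

opposite-antitone : (u v : Fin m) → toℕ u < toℕ v → toℕ (opposite v) < toℕ (opposite u)
opposite-antitone u v u<v with toℕ (opposite v) <? toℕ (opposite u)
... | yes lt = lt
... | no ≮ = ⊥-elim (<-irrefl (opposite-sums u v) (+-mono-<-≤ u<v (≮⇒≥ ≮)))

opposite-antitone-≤ : (u v : Fin m) → toℕ u ≤ toℕ v → toℕ (opposite v) ≤ toℕ (opposite u)
opposite-antitone-≤ u v u≤v with toℕ (opposite v) ≤? toℕ (opposite u)
... | yes le = le
... | no ≰ = ⊥-elim (<-irrefl (opposite-sums u v) (+-mono-≤-< u≤v (≰⇒> ≰)))

opposite-reflects-< : (u v : Fin m) → toℕ (opposite u) < toℕ (opposite v) → toℕ v < toℕ u
opposite-reflects-< u v opp< with toℕ v <? toℕ u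
... | yes lt = lt
... | no ≮ = ⊥-elim (<-irrefl refl (<-≤-trans opp< (opposite-antitone-≤ u v (≮⇒≥ ≮))))

opposite-fixed-unique : (u v : Fin m) → opposite u ≡ u → opposite v ≡ v → u ≡ v
opposite-fixed-unique u v eu ev with <-cmp (toℕ u) (toℕ v)
... | tri< u<v _ _ = ⊥-elim (<-asym u<v (subst₂ (λ a b → toℕ a < toℕ b) ev eu (opposite-antitone u v u<v)))
... | tri≈ _ u≡v _ = toℕ-injective u≡v
... | tri> _ _ v<u = ⊥-elim (<-asym v<u (subst₂ (λ a b → toℕ a < toℕ b) eu ev (opposite-antitone v u v<u)))

-- A conjugate τ ρ₀ τ⁻¹ of the reversal is an involution with at most one
-- fixed point; these are the two properties of ψ* used from regularity.
Involution : Perm m → Set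
Involution ψ = ∀ x → ψ ⟨$⟩ʳ (ψ ⟨$⟩ʳ x) ≡ x

AtMostOneFixedPoint : Perm m → Set
AtMostOneFixedPoint ψ = ∀ x y → ψ ⟨$⟩ʳ x ≡ x → ψ ⟨$⟩ʳ y ≡ y → x ≡ y

conjugate-involution : (ψ : Perm m) → ConjugateToρ₀ ψ → Involution ψ
conjugate-involution ψ (τ , e) x = begin
  ψ ⟨$⟩ʳ (ψ ⟨$⟩ʳ x)                             ≡⟨ cong (ψ ⟨$⟩ʳ_) (e x) ⟩
  ψ ⟨$⟩ʳ (τ ⟨$⟩ʳ opposite (τ ⟨$⟩ˡ x))             ≡⟨ e _ ⟩
  τ ⟨$⟩ʳ opposite (τ ⟨$⟩ˡ (τ ⟨$⟩ʳ opposite (τ ⟨$⟩ˡ x))) ≡⟨ cong (λ w → τ ⟨$⟩ʳ opposite w) (inverseˡ τ) ⟩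
  τ ⟨$⟩ʳ opposite (opposite (τ ⟨$⟩ˡ x))           ≡⟨ cong (τ ⟨$⟩ʳ_) (opposite-involutive _) ⟩
  τ ⟨$⟩ʳ (τ ⟨$⟩ˡ x)                              ≡⟨ inverseʳ τ ⟩
  x                                              ∎
  where open ≡-Reasoning

conjugate-fixed-unique : (ψ : Perm m) → ConjugateToρ₀ ψ → AtMostOneFixedPoint ψ
conjugate-fixed-unique ψ (τ , e) x y fx fy =
  trans (sym (inverseʳ τ)) (trans (cong (τ ⟨$⟩ʳ_) (opposite-fixed-unique _ _ (fixed x fx) (fixed y fy))) (inverseʳ τ))
  where
  fixed : ∀ z → ψ ⟨$⟩ʳ z ≡ z → opposite (τ ⟨$⟩ˡ z) ≡ τ ⟨$⟩ˡ z
  fixed z f = trans (sym (inverseˡ τ)) (cong (τ ⟨$⟩ˡ_) (trans (sym (e z)) f))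

half : ∀ m → Σ ℕ λ k → k + k ≤ m × m ≤ suc (k + k)
half zero          = 0 , z≤n , z≤n
half (suc zero)    = 0 , z≤n , s≤s z≤n
half (suc (suc m)) =
  let (k , low , high) = half m
  in suc k , subst (_≤ suc (suc m)) (sym (cong suc (+-suc k k))) (s≤s (s≤s low))
           , subst (suc (suc m) ≤_) (sym (cong (λ (w : ℕ) → suc (suc w)) (+-suc k k))) (s≤s (s≤s high))

Enumerates : (A → A → Set) → List A → Set
Enumerates _∼_ xs = ∀ a → Any (a ∼_) xs

decide-∃ : {_∼_ : A → A → Set} {xs : List A} {Q : A → Set} →
           Enumerates _∼_ xs → (∀ {a b} → a ∼ b → Q a → Q b) → Decidable Q → Dec (∃ Q)
decide-∃ {xs = xs} enum resp Q? with Any.any? Q? xs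
... | yes found = yes (Any.satisfied found)
... | no none = no λ (a , qa) → none (Any.map (λ a∼b → resp a∼b qa) (enum a))

-- The first member of a list satisfying a decidable predicate.  It depends
-- only on the extension of the predicate, which makes it a canonical choice.
first : {Q : A → Set} → Decidable Q → (xs : List A) → Any Q xs → A
first Q? (x ∷ xs) found with Q? x
... | yes _ = x
... | no ¬q = first Q? xs (Any.tail ¬q found)

first-satisfies : {Q : A → Set} (Q? : Decidable Q) (xs : List A) (found : Any Q xs) → Q (first Q? xs found)
first-satisfies Q? (x ∷ xs) found with Q? x
... | yes q = q
... | no ¬q = first-satisfies Q? xs (Any.tail ¬q found)

first-cong : {Q Q′ : A → Set} (Q? : Decidable Q) (Q′? : Decidable Q′) → (∀ a → Q a ⇔ Q′ a) →
             (xs : List A) (found : Any Q xs) (found′ : Any Q′ xs) → first Q? xs found ≡ first Q′? xs found′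
first-cong Q? Q′? Q⇔Q′ (x ∷ xs) found found′ with Q? x | Q′? x
... | yes _ | yes _  = refl
... | yes q | no ¬q′ = contradiction (Equivalence.to (Q⇔Q′ x) q) ¬q′
... | no ¬q | yes q′ = contradiction (Equivalence.from (Q⇔Q′ x) q′) ¬q
... | no ¬q | no ¬q′ = first-cong Q? Q′? Q⇔Q′ xs (Any.tail ¬q found) (Any.tail ¬q′ found′)

-- All permutations of Fin m: a permutation of Fin (suc m) is determined by
-- the image of zero and the induced permutation of the remaining points.
allPerms : ∀ m → List (Perm m)
allPerms zero    = [ idP ]
allPerms (suc m) = cartesianProductWith (P.insert zero) (allFin (suc m)) (allPerms m)

insert-cong : (j : Fin (suc m)) {π π′ : Perm m} → π ≈ₚ π′ → P.insert zero j π ≈ₚ P.insert zero j π′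
insert-cong j e zero    = refl
insert-cong j e (suc k) = cong (Data.Fin.Base.punchIn j) (e k)

allPerms-enumerates : ∀ m → Enumerates _≈ₚ_ (allPerms m)
allPerms-enumerates zero    σ = here (λ ())
allPerms-enumerates (suc m) σ =
  cartesianProductWith⁺ (P.insert zero) reassemble (∈-allFin (σ ⟨$⟩ʳ zero))
    (allPerms-enumerates m (P.remove zero σ))
  where
  reassemble : ∀ {j τ} → σ ⟨$⟩ʳ zero ≡ j → P.remove zero σ ≈ₚ τ → σ ≈ₚ P.insert zero j τ
  reassemble refl e i = trans (sym (P.insert-remove zero σ i)) (insert-cong (σ ⟨$⟩ʳ zero) e i)

allFunctions : List A → ∀ h → List (Fin h → A)
allFunctions xs zero    = [ (λ ()) ]
allFunctions xs (suc h) = cartesianProductWith cons xs (allFunctions xs h)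
  where
  cons : A → (Fin h → A) → Fin (suc h) → A
  cons a f zero    = a
  cons a f (suc i) = f i

allFunctions-enumerates : {_∼_ : A → A → Set} {xs : List A} → Enumerates _∼_ xs →
  ∀ h → Enumerates (λ f g → ∀ i → f i ∼ g i) (allFunctions xs h)
allFunctions-enumerates enum zero    f = here (λ ())
allFunctions-enumerates enum (suc h) f =
  cartesianProductWith⁺ _ (λ { e e′ zero → e ; e e′ (suc i) → e′ i })
    (enum (f zero)) (allFunctions-enumerates enum h (λ i → f (suc i)))

allΩ : List Ω
allΩ = ι ∷ ρ₀ ∷ []

allG : ∀ h n → List (G h n)
allG h n = cartesianProductWith (λ φ (ψ , ρ) → ⟨ φ , ψ , ρ ⟩) (allPerms h) (cartesianProduct (allPerms n) allΩ)

allG-enumerates : ∀ h n → Enumerates _≈G_ (allG h n)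
allG-enumerates h n ⟨ φ , ψ , ρ ⟩ =
  cartesianProductWith⁺ _ (λ { eφ (eψ , refl) → eφ , eψ , refl })
    (allPerms-enumerates h φ) (cartesianProduct⁺ (allPerms-enumerates n ψ) (member ρ))
  where
  member : ∀ ρ → Any (ρ ≡_) allΩ
  member ι  = here refl
  member ρ₀ = there (here refl)

allProfiles : ∀ h n → List (Profile h n)
allProfiles h n = allFunctions (allPerms n) h

allProfiles-enumerates : ∀ h n → Enumerates _≈P_ (allProfiles h n)
allProfiles-enumerates h n = allFunctions-enumerates (allPerms-enumerates n) h

module _ {h n : ℕ} where

  -- Equality in G, wrapped for the same reason as _≃_.
  infix 4 _≅_
  record _≅_ (g g′ : G h n) : Set where
    constructor mk≅
    field appG : g ≈G g′
  open _≅_ public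

  ≅-refl : {g : G h n} → g ≅ g
  ≅-refl = mk≅ ((λ _ → refl) , (λ _ → refl) , refl)

  ≅-sym : {g g′ : G h n} → g ≅ g′ → g′ ≅ g
  ≅-sym (mk≅ (eφ , eψ , eρ)) = mk≅ ((λ i → sym (eφ i)) , (λ i → sym (eψ i)) , sym eρ)

  cancelˡ : ∀ g g′ → (g ·G (invG g ·G g′)) ≅ g′
  cancelˡ g g′ = mk≅ ((λ _ → inverseʳ (φ g)) , (λ _ → inverseʳ (ψ g)) , cancelΩ (ρ g) (ρ g′))
    where
    cancelΩ : ∀ a b → a ·Ω (a ·Ω b) ≡ b
    cancelΩ ι  b  = refl
    cancelΩ ρ₀ ι  = refl
    cancelΩ ρ₀ ρ₀ = refl

  actOrd : G h n → LinOrd n → LinOrd n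
  actOrd g q = ψ g · q · ⟦ ρ g ⟧Ω

  actOrd-cong : ∀ g {q q′} → q ≃ q′ → actOrd g q ≃ actOrd g q′
  actOrd-cong g (mk≃ e) = mk≃ λ x → cong (ψ g ⟨$⟩ʳ_) (e _)

  actOrd-congG : ∀ {g g′} q → g ≅ g′ → actOrd g q ≃ actOrd g′ q
  actOrd-congG q (mk≅ (_ , eψ , refl)) = mk≃ λ x → eψ _

  actOrd-comp : ∀ g g′ q → actOrd g (actOrd g′ q) ≃ actOrd (g ·G g′) q
  actOrd-comp g g′ q = mk≃ λ x →
    cong (λ w → ψ g ⟨$⟩ʳ (ψ g′ ⟨$⟩ʳ (q ⟨$⟩ʳ w)))
      (trans (⟦⟧Ω-hom (ρ g′) (ρ g) x) (cong (λ a → ⟦ a ⟧Ω ⟨$⟩ʳ x) (·Ω-comm (ρ g′) (ρ g))))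

  -- Equality of profiles, wrapped for the same reason as _≃_.
  infix 4 _≋_
  record _≋_ (p p′ : Profile h n) : Set where
    constructor mk≋
    field appP : p ≈P p′
  open _≋_ public

  ≋-refl : {p : Profile h n} → p ≋ p
  ≋-refl = mk≋ λ _ _ → refl

  ≋-sym : {p p′ : Profile h n} → p ≋ p′ → p′ ≋ p
  ≋-sym (mk≋ e) = mk≋ λ i x → sym (e i x)

  ≋-trans : {p p′ p″ : Profile h n} → p ≋ p′ → p′ ≋ p″ → p ≋ p″
  ≋-trans (mk≋ e) (mk≋ f) = mk≋ λ i x → trans (e i x) (f i x)

  act-cong : ∀ {p p′ g g′} → p ≋ p′ → g ≅ g′ → act p g ≋ act p′ g′
  act-cong {p} {p′} {g} {g′} (mk≋ ep) eg@(mk≅ (eφ , _ , _)) = mk≋ λ i x → trans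
    (cong (λ j → actOrd g (p j) ⟨$⟩ʳ x) (≃-inverse {σ = φ g} {τ = φ g′} (mk≃ eφ) i))
    (app (≃-trans (actOrd-cong g {p (j i)} {p′ (j i)} (mk≃ (ep (j i)))) (actOrd-congG (p′ (j i)) eg)) x)
    where
    j : Fin h → Fin h
    j = φ g′ ⟨$⟩ˡ_

  act-comp : ∀ p g g′ → act (act p g′) g ≋ act p (g ·G g′)
  act-comp p g g′ = mk≋ λ i → app (actOrd-comp g g′ (p (φ g′ ⟨$⟩ˡ (φ g ⟨$⟩ˡ i))))

  act-inverse : ∀ p g → act (act p g) (invG g) ≋ p
  act-inverse p g = ≋-trans (act-comp p (invG g) g) (act-cong ≋-refl inverseG)
    where
    inverseG : (invG g ·G g) ≅ 1G
    inverseG = mk≅ ((λ _ → inverseˡ (φ g)) , (λ _ → inverseˡ (ψ g)) , ·Ω-self (ρ g))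

  _≋?_ : (p p′ : Profile h n) → Dec (p ≋ p′)
  p ≋? p′ with all? (λ i → all? (λ x → p i ⟨$⟩ʳ x ≟ p′ i ⟨$⟩ʳ x))
  ... | yes e = yes (mk≋ e)
  ... | no ¬e = no λ e → ¬e (appP e)

-- Orbits of a subgroup U and a canonical representative of each orbit,
-- chosen as the first member of the orbit in the enumeration of profiles.
module Orbits {h n : ℕ} (U : G h n → Bool) (U-subgroup : IsSubgroup U) where
  open IsSubgroup U-subgroup renaming (resp to ∈U-resp)

  Orbit : Profile h n → Profile h n → Set
  Orbit P p = Σ (G h n) λ g → g ∈ᵤ U × act P g ≋ p

  orbit? : ∀ P p → Dec (Orbit P p)
  orbit? P p = decide-∃ (λ g → Any.map mk≅ (allG-enumerates h n g)) carries (λ g → T? (U g) ×-dec (act P g ≋? p))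
    where
    carries : ∀ {a b} → a ≅ b → a ∈ᵤ U × act P a ≋ p → b ∈ᵤ U × act P b ≋ p
    carries e (u , e′) = ∈U-resp (appG e) u , ≋-trans (act-cong (≋-refl {p = P}) (≅-sym e)) e′

  orbit-cong : ∀ P {p p′} → p ≋ p′ → Orbit P p ⇔ Orbit P p′
  orbit-cong P e = mk⇔ (λ (g , u , e′) → g , u , ≋-trans e′ e) (λ (g , u , e′) → g , u , ≋-trans e′ (≋-sym e))

  orbit-act : ∀ P p {g} → g ∈ᵤ U → Orbit P p ⇔ Orbit P (act p g)
  orbit-act P p {g} u = mk⇔
    (λ (g′ , u′ , e) → g ·G g′ , mul u u′ , ≋-trans (≋-sym (act-comp P g g′)) (act-cong e (≅-refl {g = g})))
    (λ (g′ , u′ , e) → invG g ·G g′ , mul (inv u) u′ ,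
       ≋-trans (≋-sym (act-comp P (invG g) g′)) (≋-trans (act-cong e (≅-refl {g = invG g})) (act-inverse p g)))

  private
    inSomeOrbit : ∀ p → Any (λ P → Orbit P p) (allProfiles h n)
    inSomeOrbit p = Any.map (λ e → 1G , one , mk≋ λ i x → sym (e i x)) (allProfiles-enumerates h n p)

  rep : Profile h n → Profile h n
  rep p = first (λ P → orbit? P p) (allProfiles h n) (inSomeOrbit p)

  rep-orbit : ∀ p → Orbit (rep p) p
  rep-orbit p = first-satisfies (λ P → orbit? P p) (allProfiles h n) (inSomeOrbit p)

  rep-cong : ∀ {p p′} → p ≋ p′ → rep p ≡ rep p′
  rep-cong e = first-cong _ _ (λ P → orbit-cong P e) (allProfiles h n) _ _

  rep-act : ∀ p {g} → g ∈ᵤ U → rep (act p g) ≡ rep p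
  rep-act p u = sym (first-cong _ _ (λ P → orbit-act P p u) (allProfiles h n) _ _)

-- If base r is a
-- linear order fixed by Stab_U(r) for every profile r, then moving the choice
-- made at each orbit representative to the other members of the orbit gives a
-- well-defined U-equivariant choice, hence a U-symmetric resolute SPC.
module EquivariantExtension {h n : ℕ} (U : G h n → Bool) (U-subgroup : IsSubgroup U)
  (base : Profile h n → LinOrd n)
  (base-invariant : ∀ r g → g ∈ᵤ U → act r g ≋ r → actOrd g (base r) ≃ base r) where

  open IsSubgroup U-subgroup
  open Orbits U U-subgroup
  open SetoidReasoning (≃-setoid n)

  -- Two elements of U carrying r to the same profile differ by an element
  -- of Stab_U(r), so they transport base r to the same order.
  transport-unique : ∀ r g₁ g₂ → g₁ ∈ᵤ U → g₂ ∈ᵤ U → act r g₁ ≋ act r g₂ →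
                     actOrd g₁ (base r) ≃ actOrd g₂ (base r)
  transport-unique r g₁ g₂ u₁ u₂ e = begin
    actOrd g₁ (base r)                          ≈⟨ actOrd-congG (base r) (≅-sym (cancelˡ g₂ g₁)) ⟩
    actOrd (g₂ ·G (invG g₂ ·G g₁)) (base r)     ≈⟨ ≃-sym (actOrd-comp g₂ (invG g₂ ·G g₁) (base r)) ⟩
    actOrd g₂ (actOrd (invG g₂ ·G g₁) (base r)) ≈⟨ actOrd-cong g₂ (base-invariant r _ (mul (inv u₂) u₁) stabilises) ⟩
    actOrd g₂ (base r)                          ∎
    where
    stabilises : act r (invG g₂ ·G g₁) ≋ r
    stabilises = ≋-trans (≋-sym (act-comp r (invG g₂) g₁))
                   (≋-trans (act-cong e (≅-refl {g = invG g₂})) (act-inverse r g₂))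

  transport-unique′ : ∀ {r r′ p} g g′ → r ≡ r′ → g ∈ᵤ U → g′ ∈ᵤ U → act r g ≋ p → act r′ g′ ≋ p →
                      actOrd g (base r) ≃ actOrd g′ (base r′)
  transport-unique′ g g′ refl u u′ e e′ = transport-unique _ g g′ u u′ (≋-trans e (≋-sym e′))

  carrier : Profile h n → G h n
  carrier p = proj₁ (rep-orbit p)

  carrier∈U : ∀ p → carrier p ∈ᵤ U
  carrier∈U p = proj₁ (proj₂ (rep-orbit p))

  carrier-sends : ∀ p → act (rep p) (carrier p) ≋ p
  carrier-sends p = proj₂ (proj₂ (rep-orbit p))

  extension : Profile h n → LinOrd n
  extension p = actOrd (carrier p) (base (rep p))

  extension-cong : ∀ {p p′} → p ≋ p′ → extension p ≃ extension p′
  extension-cong {p} {p′} e = transport-unique′ (carrier p) (carrier p′) (rep-cong e)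
    (carrier∈U p) (carrier∈U p′) (≋-trans (carrier-sends p) e) (carrier-sends p′)

  extension-equivariant : ∀ p g → g ∈ᵤ U → extension (act p g) ≃ actOrd g (extension p)
  extension-equivariant p g u = begin
    extension (act p g)                        ≈⟨ transport-unique′ (carrier (act p g)) (g ·G carrier p) (rep-act p u)
                                                    (carrier∈U (act p g)) (mul u (carrier∈U p))
                                                    (carrier-sends (act p g)) carried ⟩
    actOrd (g ·G carrier p) (base (rep p))     ≈⟨ ≃-sym (actOrd-comp g (carrier p) (base (rep p))) ⟩
    actOrd g (extension p)                     ∎
    where
    carried : act (rep p) (g ·G carrier p) ≋ act p g
    carried = ≋-trans (≋-sym (act-comp (rep p) g (carrier p))) (act-cong (carrier-sends p) (≅-refl {g = g}))

  extensionSPC : SPC h n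
  extensionSPC = record
    { mem  = λ p q → isYes (q ≃? extension p)
    ; resp = λ {_} {_} {q} {q′} ep eq t →
        fromWitness (≃-trans (≃-sym (mk≃ {σ = q} {τ = q′} eq)) (≃-trans (toWitness t) (extension-cong (mk≋ ep)))) }

  extensionSPC-resolute : Resolute extensionSPC
  extensionSPC-resolute p = extension p , fromWitness ≃-refl , λ q t → app (toWitness t)

  extensionSPC-symmetric : USymmetricSPC U extensionSPC
  extensionSPC-symmetric p g u q = mk⇔
    (λ t → extension p , fromWitness ≃-refl , app (≃-trans (toWitness t) (extension-equivariant p g u)))
    (λ (q′ , t , e) → fromWitness (begin
       q                     ≈⟨ mk≃ e ⟩
       actOrd g q′           ≈⟨ actOrd-cong g (toWitness t) ⟩
       actOrd g (extension p) ≈⟨ ≃-sym (extension-equivariant p g u) ⟩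
       extension (act p g)   ∎))

  -- If C is U-symmetric and contains every base r, it contains every
  -- transported order, since extension p = carrier(p) · base (rep p).
  extensionSPC-refines : (C : SPC h n) → USymmetricSPC U C → (∀ r → base r ∈C (r , C)) →
                         Refines extensionSPC C
  extensionSPC-refines C C-symmetric base∈C p q t =
    SPC.resp C (appP (carrier-sends p)) (app (≃-sym (toWitness t)))
      (Equivalence.from (C-symmetric (rep p) (carrier p) (carrier∈U p) (extension p))
        (base (rep p) , base∈C (rep p) , λ _ → refl))

IrreflexiveRel : Relation n → Set
IrreflexiveRel A = ∀ x → ¬ ((x , x) ∈R A)

AcyclicRel : Relation n → Set
AcyclicRel {n} A = ∀ (x : Fin n) ys z → Unique (x ∷ ys ++ [ z ]) →
  Linked (λ a b → (a , b) ∈R A) (x ∷ ys ++ [ z ]) → ¬ ((z , x) ∈R A)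

pos : Perm n → Fin n → ℕ
pos π y = toℕ (π ⟨$⟩ˡ y)

unique-length : {xs : List (Fin n)} → Unique xs → length xs ≤ n
unique-length u = injective⇒≤ (lookup-injective u)
  where
  lookup-fresh : ∀ {x} {xs : List A} → All (x ≢_) xs → ∀ j → x ≢ lookup xs j
  lookup-fresh (d ∷ _)  zero    = d
  lookup-fresh (_ ∷ ds) (suc j) = lookup-fresh ds j
  lookup-injective : {xs : List A} → Unique xs → ∀ {i j} → lookup xs i ≡ lookup xs j → i ≡ j
  lookup-injective (_ ∷ _)     {zero}  {zero}  _ = refl
  lookup-injective (fresh ∷ _) {zero}  {suc j} e = ⊥-elim (lookup-fresh fresh j e)
  lookup-injective (fresh ∷ _) {suc i} {zero}  e = ⊥-elim (lookup-fresh fresh i (sym e))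
  lookup-injective (_ ∷ u)     {suc i} {suc j} e = cong suc (lookup-injective u e)

module _ (i j : Fin n) where

  transpose-left : PC.transpose i j i ≡ j
  transpose-left with i ≟ i
  ... | yes _  = refl
  ... | no i≢i = contradiction refl i≢i

  transpose-fixes : ∀ {k} → k ≢ i → k ≢ j → PC.transpose i j k ≡ k
  transpose-fixes {k} k≢i k≢j with k ≟ i
  ... | yes k≡i = contradiction k≡i k≢i
  ... | no _ with k ≟ j
  ...   | yes k≡j = contradiction k≡j k≢j
  ...   | no _    = refl

  module _ (Q : Fin n → Set) (Qi : Q i) (Qj : Q j) where

    transpose-preserves : ∀ {k} → Q k → Q (PC.transpose i j k)
    transpose-preserves {k} Qk with k ≟ i
    ... | yes refl = Qj
    ... | no _ with k ≟ j
    ...   | yes refl = Qi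
    ...   | no _     = Qk

    transpose-outside : ∀ {k} → ¬ Q k → PC.transpose i j k ≡ k
    transpose-outside ¬Qk = transpose-fixes (λ { refl → ¬Qk Qi }) (λ { refl → ¬Qk Qj })

-- place π i x: the order π with x moved to rank i, by swapping it with the
-- element previously at rank i.  Outside any region of ranks containing i
-- and the old rank of x, nothing moves.
module Placement (π : Perm n) (i x : Fin n) where

  placed : Perm n
  placed = π · P.transpose i (π ⟨$⟩ˡ x)

  placed-at : placed ⟨$⟩ʳ i ≡ x
  placed-at = trans (cong (π ⟨$⟩ʳ_) (transpose-left i (π ⟨$⟩ˡ x))) (inverseʳ π)

  placed-fixes : ∀ {r} → r ≢ i → r ≢ π ⟨$⟩ˡ x → placed ⟨$⟩ʳ r ≡ π ⟨$⟩ʳ r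
  placed-fixes r≢i r≢x = cong (π ⟨$⟩ʳ_) (transpose-fixes i (π ⟨$⟩ˡ x) r≢i r≢x)

  placed-outside : (Q : Fin n → Set) → Q i → Q (π ⟨$⟩ˡ x) → ∀ {r} → ¬ Q r → placed ⟨$⟩ʳ r ≡ π ⟨$⟩ʳ r
  placed-outside Q Qi Qx ¬Qr = cong (π ⟨$⟩ʳ_) (transpose-outside i (π ⟨$⟩ˡ x) Q Qi Qx ¬Qr)

  placed-rank-outside : (Q : Fin n → Set) → Q i → Q (π ⟨$⟩ˡ x) → ∀ {y} → ¬ Q (π ⟨$⟩ˡ y) → placed ⟨$⟩ˡ y ≡ π ⟨$⟩ˡ y
  placed-rank-outside Q Qi Qx ¬Qy = transpose-outside (π ⟨$⟩ˡ x) i Q Qx Qi ¬Qy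

  placed-rank-inside : (Q : Fin n → Set) → Q i → Q (π ⟨$⟩ˡ x) → ∀ y → Q (placed ⟨$⟩ˡ y) ⇔ Q (π ⟨$⟩ˡ y)
  placed-rank-inside Q Qi Qx y = mk⇔
    (λ Q′ → subst Q (PC.transpose-inverse i (π ⟨$⟩ˡ x)) (transpose-preserves i (π ⟨$⟩ˡ x) Q Qi Qx Q′))
    (transpose-preserves (π ⟨$⟩ˡ x) i Q Qx Qi)

-- Starting anywhere in S, walk backwards along predecessors in S;
-- acyclicity keeps the walk a simple path, which cannot outgrow Fin n.
module Sources {n : ℕ} (E : Relation n) (irreflexive : IrreflexiveRel E) (acyclic : AcyclicRel E) where

  _⇝_ : Fin n → Fin n → Set
  a ⇝ b = (a , b) ∈R E

  IsSource : (Fin n → Bool) → Fin n → Set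
  IsSource S x = T (S x) × (∀ y → T (S y) → ¬ y ⇝ x)

  no-return : ∀ {y x path} → y ∈ (x ∷ path) → y ⇝ x → Unique (x ∷ path) → Linked _⇝_ (x ∷ path) → ⊥
  no-return (here refl) y⇝x _ _ = irreflexive _ y⇝x
  no-return {y} {x} (there y∈path) y⇝x u l with ∈-∃++ y∈path
  ... | ys , zs , refl = acyclic x ys y (prefix-unique u′) (prefix-linked (x ∷ ys ++ [ y ]) l′) y⇝x
    where
    split : x ∷ ys ++ [ y ] ++ zs ≡ (x ∷ ys ++ [ y ]) ++ zs
    split = cong (x ∷_) (sym (++-assoc ys [ y ] zs))
    u′ : Unique ((x ∷ ys ++ [ y ]) ++ zs)
    u′ = subst Unique split u
    l′ : Linked _⇝_ ((x ∷ ys ++ [ y ]) ++ zs)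
    l′ = subst (Linked _⇝_) split l
    prefix-unique : ∀ {xs zs : List (Fin n)} → Unique (xs ++ zs) → Unique xs
    prefix-unique {[]}     _           = []
    prefix-unique {_ ∷ xs} (fresh ∷ u) = ++⁻ˡ xs fresh ∷ prefix-unique u
    prefix-linked : ∀ xs {zs : List (Fin n)} → Linked _⇝_ (xs ++ zs) → Linked _⇝_ xs
    prefix-linked []           _       = []
    prefix-linked (_ ∷ [])     _       = [-]
    prefix-linked (_ ∷ y ∷ xs) (e ∷ l) = e ∷ prefix-linked (y ∷ xs) l

  -- The walk: x is the current point and x ∷ path the simple path behind it;
  -- the fuel bounds the number of further steps.
  walk : (S : Fin n → Bool) (fuel : ℕ) (x : Fin n) (path : List (Fin n)) →
         Unique (x ∷ path) → Linked _⇝_ (x ∷ path) → T (S x) → n < length (x ∷ path) + fuel →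
         ∃ (IsSource S)
  walk S zero x path u l Sx long =
    ⊥-elim (<-irrefl refl (<-≤-trans long (subst (_≤ n) (sym (+-identityʳ _)) (unique-length u))))
  walk S (suc fuel) x path u l Sx long with any? (λ y → T? (S y) ×-dec T? (E y x))
  ... | no none = x , Sx , λ y Sy y⇝x → none (y , Sy , y⇝x)
  ... | yes (y , Sy , y⇝x) with Any.any? (y ≟_) (x ∷ path)
  ...   | yes y∈path = ⊥-elim (no-return y∈path y⇝x u l)
  ...   | no y∉path  = walk S fuel y (x ∷ path) (¬Any⇒All¬ _ y∉path ∷ u) (y⇝x ∷ l) Sy
                         (subst (n <_) (+-suc _ fuel) long)

  source : (S : Fin n → Bool) → ∀ x → T (S x) → ∃ (IsSource S)
  source S x Sx = walk S n x [] ([] ∷ []) [-] Sx (s≤s (m≤n+m n 0))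

-- Linear extensions, built rank by rank: SourcesAbove π k says that for every
-- rank r < k the element at rank r is an E-source among the ranks ≥ r.
module LinearExtension {n : ℕ} (E : Relation n) (irreflexive : IrreflexiveRel E) (acyclic : AcyclicRel E) where
  open Sources E irreflexive acyclic

  SourcesAbove : Perm n → ℕ → Set
  SourcesAbove π k = ∀ (r : Fin n) → toℕ r < k → ∀ y → toℕ r ≤ pos π y → ¬ y ⇝ (π ⟨$⟩ʳ r)

  sources-extend : ∀ π → SourcesAbove π n → ∀ a b → a ⇝ b → pos π a < pos π b
  sources-extend π above a b a⇝b with pos π a <? pos π b
  ... | yes a<b = a<b
  ... | no a≮b = ⊥-elim (above (π ⟨$⟩ˡ b) (toℕ<n _) a (≮⇒≥ a≮b) (subst (a ⇝_) (sym (inverseʳ π)) a⇝b))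

  -- Rank k is filled with a source x of the ranks ≥ k, moved there from
  -- below; the ranks above k do not move.
  step : ∀ k π → k < n → SourcesAbove π k → Σ (Perm n) λ π′ → SourcesAbove π′ (suc k)
  step k π k<n above = placed , above′
    where
    kF : Fin n
    kF = fromℕ< k<n
    Low : Fin n → Set
    Low r = k ≤ toℕ r
    S : Fin n → Bool
    S y = isYes (k ≤? pos π y)
    Low-kF : Low kF
    Low-kF = ≤-reflexive (sym (toℕ-fromℕ< k<n))
    chosen : ∃ (IsSource S)
    chosen = source S (π ⟨$⟩ʳ kF) (fromWitness (subst Low (sym (inverseˡ π)) Low-kF))
    x : Fin n
    x = proj₁ chosen
    open Placement π kF x
    Low-x : Low (π ⟨$⟩ˡ x)
    Low-x = toWitness (proj₁ (proj₂ chosen))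
    above′ : SourcesAbove placed (suc k)
    above′ r r≤k y r≤y with m≤n⇒m<n∨m≡n (≤-pred r≤k)
    ... | inj₁ r<k = subst (λ z → ¬ y ⇝ z) (sym (placed-outside Low Low-kF Low-x (λ k≤r → <-irrefl refl (<-≤-trans r<k k≤r))))
                       (above r r<k y r≤old-rank)
      where
      r≤old-rank : toℕ r ≤ pos π y
      r≤old-rank with k ≤? pos π y
      ... | yes k≤y = ≤-trans (<⇒≤ r<k) k≤y
      ... | no k≰y  = subst (λ z → toℕ r ≤ toℕ z) (placed-rank-outside Low Low-kF Low-x k≰y) r≤y
    ... | inj₂ r≡k with toℕ-injective (trans r≡k (sym (toℕ-fromℕ< k<n)))
    ...   | refl = subst (λ z → ¬ y ⇝ z) (sym placed-at)
                     (proj₂ (proj₂ chosen) y (fromWitness (Equivalence.to (placed-rank-inside Low Low-kF Low-x y) (subst (_≤ pos placed y) r≡k r≤y))))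

  build : ∀ k → k ≤ n → Σ (Perm n) λ π → SourcesAbove π k
  build zero    _   = idP , λ r ()
  build (suc k) k<n = let (π , above) = build k (<⇒≤ k<n) in step k π k<n above

  linear-extension : Σ (Perm n) λ π → ∀ a b → a ⇝ b → pos π a < pos π b
  linear-extension = let (π , above) = build n ≤-refl in π , sources-extend π above

-- Let ψ be an involution of N with at most one
-- fixed point such that x E y implies ψ y E ψ x.  Then E has a linear
-- extension q with ψ q ρ₀ = q, i.e. ψ maps the element of rank r to the
-- element of rank n-1-r.  It is built from the outside in: at stage k the
-- ranks r < k and n-1-r are filled, and the free ranks form the band
-- k ≤ r ≤ n-1-k, which is closed under ψ.  The next pair is a source x of the
-- band with ψ x ≠ x, placed at rank k, together with ψ x at rank n-1-k.
module SelfDualExtension {n : ℕ} (E : Relation n) (irreflexive : IrreflexiveRel E) (acyclic : AcyclicRel E)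
  (ψ : Perm n) (ψ-involution : Involution ψ) (ψ-fixed : AtMostOneFixedPoint ψ)
  (ψ-reverses : ∀ x y → (x , y) ∈R E → (ψ ⟨$⟩ʳ y , ψ ⟨$⟩ʳ x) ∈R E) where
  open Sources E irreflexive acyclic

  dual : Fin n → Fin n
  dual x = ψ ⟨$⟩ʳ x

  dual-injective : ∀ {a b} → dual a ≡ dual b → a ≡ b
  dual-injective = perm-injective ψ

  dual-edge : ∀ {x y} → dual x ⇝ y → dual y ⇝ x
  dual-edge {x} {y} e = subst (λ z → dual y ⇝ z) (ψ-involution x) (ψ-reverses (dual x) y e)

  Band : ℕ → Fin n → Set
  Band k r = k ≤ toℕ r × k ≤ toℕ (opposite r)

  band? : ∀ k r → Dec (Band k r)
  band? k r = (k ≤? toℕ r) ×-dec (k ≤? toℕ (opposite r))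

  band-opposite : ∀ {k r} → Band k r → Band k (opposite r)
  band-opposite {r = r} (k≤r , k≤o) = k≤o , subst (λ z → _ ≤ toℕ z) (sym (opposite-involutive r)) k≤r

  classify : ∀ k r → toℕ r < k ⊎ toℕ (opposite r) < k ⊎ Band k r
  classify k r with toℕ r <? k | toℕ (opposite r) <? k
  ... | yes top | _          = inj₁ top
  ... | no _    | yes bottom = inj₂ (inj₁ bottom)
  ... | no r≮k  | no o≮k     = inj₂ (inj₂ (≮⇒≥ r≮k , ≮⇒≥ o≮k))

  -- Rank r of π is settled if it holds a source of the ranks ≥ r, which ψ
  -- maps to the element of rank n-1-r; stage k has the ranks r < k settled.
  Settled : Perm n → Fin n → Set
  Settled π r = (dual (π ⟨$⟩ʳ r) ≡ π ⟨$⟩ʳ opposite r) × (∀ y → toℕ r ≤ pos π y → ¬ y ⇝ (π ⟨$⟩ʳ r))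

  Paired : Perm n → ℕ → Set
  Paired π k = ∀ (r : Fin n) → toℕ r < k → Settled π r

  bottom-of : ∀ {k} r → k ≤ toℕ r → ¬ Band k r → toℕ (opposite r) < k
  bottom-of r k≤r ¬band = ≰⇒> (λ k≤o → ¬band (k≤r , k≤o))

  paired-suc : ∀ {π k} (kF : Fin n) → toℕ kF ≡ k → Paired π k → Settled π kF → Paired π (suc k)
  paired-suc kF kF-rank paired settled r r≤k with m≤n⇒m<n∨m≡n (≤-pred r≤k)
  ... | inj₁ r<k = paired r r<k
  ... | inj₂ r≡k with toℕ-injective (trans r≡k (sym kF-rank))
  ...   | refl = settled

  module Stage (π : Perm n) (k : ℕ) (paired : Paired π k) where

    mirror : ∀ s → ¬ Band k s → dual (π ⟨$⟩ʳ s) ≡ π ⟨$⟩ʳ opposite s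
    mirror s ¬band with classify k s
    ... | inj₁ top           = proj₁ (paired s top)
    ... | inj₂ (inj₁ bottom) = dual-injective (trans (ψ-involution _) (sym partner))
      where
      partner : dual (π ⟨$⟩ʳ opposite s) ≡ π ⟨$⟩ʳ s
      partner = trans (proj₁ (paired (opposite s) bottom)) (cong (π ⟨$⟩ʳ_) (opposite-involutive s))
    ... | inj₂ (inj₂ band)   = contradiction band ¬band

    rank-mirror : ∀ s → ¬ Band k s → π ⟨$⟩ˡ dual (π ⟨$⟩ʳ s) ≡ opposite s
    rank-mirror s ¬band = trans (cong (π ⟨$⟩ˡ_) (mirror s ¬band)) (inverseˡ π)

    band-closed : ∀ y → Band k (π ⟨$⟩ˡ y) → Band k (π ⟨$⟩ˡ dual y)
    band-closed y band with band? k (π ⟨$⟩ˡ dual y)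
    ... | yes band′ = band′
    ... | no ¬band′ = ⊥-elim (¬band′ (subst (Band k) s≡opp (band-opposite band)))
      where
      s : Fin n
      s = π ⟨$⟩ˡ dual y
      y≡ : y ≡ π ⟨$⟩ʳ opposite s
      y≡ = trans (sym (ψ-involution y)) (trans (cong dual (sym (inverseʳ π))) (mirror s ¬band′))
      s≡opp : opposite (π ⟨$⟩ˡ y) ≡ s
      s≡opp = trans (cong (λ z → opposite (π ⟨$⟩ˡ z)) y≡)
                (trans (cong opposite (inverseˡ π)) (opposite-involutive s))

    sink-below : ∀ s → toℕ (opposite s) < k → ∀ y → pos π y ≤ toℕ s → ¬ (π ⟨$⟩ʳ s) ⇝ y
    sink-below s bottom y y≤s e =
      proj₂ (paired (opposite s) bottom) (dual y) high
        (subst (λ z → dual y ⇝ z) (mirror s outside) (dual-edge (subst (_⇝ y) (sym (ψ-involution _)) e)))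
      where
      outside : ¬ Band k s
      outside (_ , k≤o) = <-irrefl refl (<-≤-trans bottom k≤o)
      high : toℕ (opposite s) ≤ pos π (dual y)
      high with band? k (π ⟨$⟩ˡ y)
      ... | yes band = ≤-trans (<⇒≤ bottom) (proj₁ (band-closed y band))
      ... | no ¬band = subst (λ z → toℕ (opposite s) ≤ toℕ z) (sym rank)
                          (opposite-antitone-≤ (π ⟨$⟩ˡ y) s y≤s)
        where
        rank : π ⟨$⟩ˡ dual y ≡ opposite (π ⟨$⟩ˡ y)
        rank = trans (cong (λ z → π ⟨$⟩ˡ dual z) (sym (inverseʳ π))) (rank-mirror (π ⟨$⟩ˡ y) ¬band)

    InBand : Fin n → Bool
    InBand y = isYes (band? k (π ⟨$⟩ˡ y))

    -- If the
    -- source x₁ found first is the fixed point of ψ, a source of the band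
    -- without x₁ is a source of the whole band (x₁ E y would give ψ y E x₁)
    -- and is not fixed, as ψ has only one fixed point.
    unfixed-source : ∀ a b → a ≢ b → T (InBand a) → T (InBand b) →
                     Σ (Fin n) λ x → IsSource InBand x × dual x ≢ x
    unfixed-source a b a≢b Ia Ib with source InBand a Ia
    ... | x₁ , src₁ with dual x₁ ≟ x₁
    ...   | no moved = x₁ , src₁ , moved
    ...   | yes fixed = y₁ , (In-y₁ , y₁-source) , λ y₁-fixed → y₁≢x₁ (ψ-fixed y₁ x₁ y₁-fixed fixed)
      where
      Others : Fin n → Bool
      Others y = isYes (T? (InBand y) ×-dec ¬? (y ≟ x₁))
      other : Σ (Fin n) λ w → T (Others w)
      other with a ≟ x₁
      ... | no a≢x₁ = a , fromWitness (Ia , a≢x₁)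
      ... | yes refl = b , fromWitness (Ib , λ b≡a → a≢b (sym b≡a))
      found : ∃ (IsSource Others)
      found = source Others (proj₁ other) (proj₂ other)
      y₁ : Fin n
      y₁ = proj₁ found
      In-y₁ : T (InBand y₁)
      In-y₁ = proj₁ (toWitness (proj₁ (proj₂ found)))
      y₁≢x₁ : y₁ ≢ x₁
      y₁≢x₁ = proj₂ (toWitness (proj₁ (proj₂ found)))
      y₁-source : ∀ z → T (InBand z) → ¬ z ⇝ y₁
      y₁-source z Iz z⇝y₁ with z ≟ x₁
      ... | yes refl = proj₂ src₁ (dual y₁) (fromWitness (band-closed y₁ (toWitness In-y₁)))
                         (dual-edge (subst (_⇝ y₁) (sym fixed) z⇝y₁))
      ... | no z≢x₁ = proj₂ (proj₂ found) z (fromWitness (Iz , z≢x₁)) z⇝y₁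

    -- Filling ranks k and n-1-k, possible while the band has two ranks.
    module Extend (wide : suc (suc (k + k)) ≤ n) where

      kF : Fin n
      kF = fromℕ< (<-≤-trans (s≤s (m≤m+n k k)) (≤-trans (n≤1+n _) wide))

      oF : Fin n
      oF = opposite kF

      kF-rank : toℕ kF ≡ k
      kF-rank = toℕ-fromℕ< _

      k<oF : k < toℕ oF
      k<oF = +-cancelˡ-≤ k (suc k) (toℕ oF) (subst (_≤ k + toℕ oF) (sym (+-suc k k))
               (≤-pred (≤-trans wide (≤-reflexive (sym (subst (λ w → suc (w + toℕ oF) ≡ n) kF-rank (opposite-sum kF)))))))

      band-kF : Band k kF
      band-kF = ≤-reflexive (sym kF-rank) , <⇒≤ k<oF

      band-oF : Band k oF
      band-oF = <⇒≤ k<oF , subst (λ z → k ≤ toℕ z) (sym (opposite-involutive kF)) (≤-reflexive (sym kF-rank))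

      kF≢oF : kF ≢ oF
      kF≢oF e = <-irrefl (trans (sym kF-rank) (cong toℕ e)) k<oF

      in-band : ∀ r → Band k r → T (InBand (π ⟨$⟩ʳ r))
      in-band r band = fromWitness (subst (Band k) (sym (inverseˡ π)) band)

      chosen : Σ (Fin n) λ x → IsSource InBand x × dual x ≢ x
      chosen = unfixed-source (π ⟨$⟩ʳ kF) (π ⟨$⟩ʳ oF) (λ e → kF≢oF (perm-injective π e))
                 (in-band kF band-kF) (in-band oF band-oF)

      x : Fin n
      x = proj₁ chosen

      band-x : Band k (π ⟨$⟩ˡ x)
      band-x = toWitness (proj₁ (proj₁ (proj₂ chosen)))

      module First = Placement π kF x
      π₁ : Perm n
      π₁ = First.placed

      band-dual-x : Band k (π₁ ⟨$⟩ˡ dual x)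
      band-dual-x = Equivalence.from (First.placed-rank-inside (Band k) band-kF band-x (dual x)) (band-closed x band-x)

      module Second = Placement π₁ oF (dual x)
      π₂ : Perm n
      π₂ = Second.placed

      π₂-kF : π₂ ⟨$⟩ʳ kF ≡ x
      π₂-kF = trans (Second.placed-fixes kF≢oF (λ e → proj₂ (proj₂ chosen) (sym (trans (sym First.placed-at) (trans (cong (π₁ ⟨$⟩ʳ_) e) (inverseʳ π₁))))))
                First.placed-at

      π₂-outside : ∀ {r} → ¬ Band k r → π₂ ⟨$⟩ʳ r ≡ π ⟨$⟩ʳ r
      π₂-outside ¬band = trans (Second.placed-outside (Band k) band-oF band-dual-x ¬band)
                               (First.placed-outside (Band k) band-kF band-x ¬band)

      π₂-band : ∀ y → Band k (π₂ ⟨$⟩ˡ y) ⇔ Band k (π ⟨$⟩ˡ y)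
      π₂-band y = ⇔.trans (Second.placed-rank-inside (Band k) band-oF band-dual-x y)
                          (First.placed-rank-inside (Band k) band-kF band-x y)

      π₂-rank-outside : ∀ y → ¬ Band k (π ⟨$⟩ˡ y) → π₂ ⟨$⟩ˡ y ≡ π ⟨$⟩ˡ y
      π₂-rank-outside y ¬band = trans (Second.placed-rank-outside (Band k) band-oF band-dual-x ¬band₁)
                                      (First.placed-rank-outside (Band k) band-kF band-x ¬band)
        where
        ¬band₁ : ¬ Band k (π₁ ⟨$⟩ˡ y)
        ¬band₁ = subst (λ z → ¬ Band k z) (sym (First.placed-rank-outside (Band k) band-kF band-x ¬band)) ¬band

      outside-top : ∀ {r : Fin n} → toℕ r < k → ¬ Band k r
      outside-top r<k (k≤r , _) = <-irrefl refl (<-≤-trans r<k k≤r)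

      outside-bottom : ∀ {r : Fin n} → toℕ r < k → ¬ Band k (opposite r)
      outside-bottom {r} r<k (_ , k≤o) = <-irrefl refl (<-≤-trans r<k (subst (λ z → k ≤ toℕ z) (opposite-involutive r) k≤o))

      old-rank : ∀ (r : Fin n) → toℕ r < k → ∀ y → toℕ r ≤ pos π₂ y → toℕ r ≤ pos π y
      old-rank r r<k y r≤y = [ (λ band → ≤-trans (<⇒≤ r<k) (proj₁ band))
                             , (λ ¬band → subst (λ z → toℕ r ≤ toℕ z) (π₂-rank-outside y ¬band) r≤y)
                             ]′ (toSum (band? k (π ⟨$⟩ˡ y)))

      paired-old : Paired π₂ k
      paired-old r r<k =
        trans (cong dual (π₂-outside (outside-top r<k))) (trans (proj₁ (paired r r<k)) (sym (π₂-outside (outside-bottom r<k)))) ,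
        λ y r≤y → subst (λ z → ¬ y ⇝ z) (sym (π₂-outside (outside-top r<k))) (proj₂ (paired r r<k) y (old-rank r r<k y r≤y))

      -- x at rank k is a source of the ranks ≥ k: of the band by choice, and
      -- of the bottom ranks because those hold sinks
      source-of : ∀ y → k ≤ pos π₂ y → ¬ y ⇝ x
      source-of y k≤y = [ (λ band → proj₂ (proj₁ (proj₂ chosen)) y (fromWitness (Equivalence.to (π₂-band y) band)))
                        , (λ ¬band → from-bottom (¬band ∘ Equivalence.from (π₂-band y)))
                        ]′ (toSum (band? k (π₂ ⟨$⟩ˡ y)))
        where
        from-bottom : ¬ Band k (π ⟨$⟩ˡ y) → ¬ y ⇝ x
        from-bottom ¬band = subst (λ z → ¬ z ⇝ x) (inverseʳ π)
          (sink-below (π ⟨$⟩ˡ y) below x (<⇒≤ (opposite-reflects-< _ _ (<-≤-trans below (proj₂ band-x)))))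
          where
          below : toℕ (opposite (π ⟨$⟩ˡ y)) < k
          below = bottom-of (π ⟨$⟩ˡ y) (subst (λ z → k ≤ toℕ z) (π₂-rank-outside y ¬band) k≤y) ¬band

      settled-kF : Settled π₂ kF
      settled-kF = trans (cong dual π₂-kF) (sym Second.placed-at) , λ y k≤y → subst (λ z → ¬ y ⇝ z) (sym π₂-kF) (source-of y (subst (_≤ pos π₂ y) kF-rank k≤y))

      paired′ : Paired π₂ (suc k)
      paired′ = paired-suc {π₂} kF kF-rank paired-old settled-kF

  build : ∀ k → k + k ≤ n → Σ (Perm n) λ π → Paired π k
  build zero    _    = idP , λ r ()
  build (suc k) wide =
    let (π , paired) = build k (≤-trans (+-mono-≤ (n≤1+n k) (n≤1+n k)) wide)
        open Stage.Extend π k paired (subst (_≤ n) (+-suc (suc k) k) wide)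
    in π₂ , paired′

  -- Once at most one rank is left in the band, the order is complete.
  module Complete (q : Perm n) (k : ℕ) (paired : Paired q k) (narrow : n ≤ suc (k + k)) where
    open Stage q k paired
    open ≡-Reasoning

    band-middle : ∀ {r} → Band k r → toℕ r ≡ k
    band-middle {r} (k≤r , k≤o) = ≤-antisym r≤k k≤r
      where
      r≤k : toℕ r ≤ k
      r≤k = +-cancelʳ-≤ k (toℕ r) k (≤-trans (+-monoʳ-≤ (toℕ r) k≤o)
              (≤-pred (≤-trans (≤-reflexive (opposite-sum r)) narrow)))

    band-unique : ∀ {r s} → Band k r → Band k s → r ≡ s
    band-unique br bs = toℕ-injective (trans (band-middle br) (sym (band-middle bs)))

    mirror-everywhere : ∀ s → dual (q ⟨$⟩ʳ s) ≡ q ⟨$⟩ʳ opposite s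
    mirror-everywhere s = [ middle , mirror s ]′ (toSum (band? k s))
      where
      -- the middle rank is its own opposite and holds the fixed point of ψ
      middle : Band k s → dual (q ⟨$⟩ʳ s) ≡ q ⟨$⟩ʳ opposite s
      middle band = begin
        dual (q ⟨$⟩ʳ s)                  ≡⟨ inverseʳ q ⟨
        q ⟨$⟩ʳ (q ⟨$⟩ˡ dual (q ⟨$⟩ʳ s))  ≡⟨ cong (q ⟨$⟩ʳ_) (band-unique (band-closed (q ⟨$⟩ʳ s) band′) (band-opposite band)) ⟩
        q ⟨$⟩ʳ opposite s                ∎
        where
        band′ : Band k (q ⟨$⟩ˡ (q ⟨$⟩ʳ s))
        band′ = subst (Band k) (sym (inverseˡ q)) band

    self-dual : ∀ r → dual (q ⟨$⟩ʳ opposite r) ≡ q ⟨$⟩ʳ r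
    self-dual r = trans (mirror-everywhere (opposite r)) (cong (q ⟨$⟩ʳ_) (opposite-involutive r))

    extends : ∀ a b → a ⇝ b → pos q a < pos q b
    extends a b a⇝b with pos q a <? pos q b
    ... | yes a<b = a<b
    ... | no a≮b = ⊥-elim (by-cases (≮⇒≥ a≮b) (subst₂ _⇝_ (sym (inverseʳ q)) (sym (inverseʳ q)) a⇝b))
      where
      ra rb : Fin n
      ra = q ⟨$⟩ˡ a
      rb = q ⟨$⟩ˡ b
      by-cases : toℕ rb ≤ toℕ ra → ¬ (q ⟨$⟩ʳ ra) ⇝ (q ⟨$⟩ʳ rb)
      by-cases rb≤ra with toℕ rb <? k | toℕ (opposite ra) <? k
      ... | yes top | _          = proj₂ (paired rb top) (q ⟨$⟩ʳ ra) (subst (λ z → toℕ rb ≤ toℕ z) (sym (inverseˡ q)) rb≤ra)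
      ... | no _    | yes bottom = sink-below ra bottom (q ⟨$⟩ʳ rb) (subst (λ z → toℕ z ≤ toℕ ra) (sym (inverseˡ q)) rb≤ra)
      ... | no rb≮k | no ra≮k    = λ e → irreflexive _ (subst (λ z → (q ⟨$⟩ʳ ra) ⇝ (q ⟨$⟩ʳ z)) (sym same) e)
        where
        same : ra ≡ rb
        same = band-unique (≤-trans (≮⇒≥ rb≮k) rb≤ra , ≮⇒≥ ra≮k)
                           (≮⇒≥ rb≮k , ≤-trans (≮⇒≥ ra≮k) (opposite-antitone-≤ rb ra rb≤ra))

  self-dual-extension : Σ (Perm n) λ q → (∀ a b → a ⇝ b → pos q a < pos q b) × (∀ r → dual (q ⟨$⟩ʳ opposite r) ≡ q ⟨$⟩ʳ r)
  self-dual-extension =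
    let (k , low , narrow) = half n
        (q , paired) = build k low
        open Complete q k paired narrow
    in q , extends , self-dual

StrictlyMonotone : (Fin n → Fin n) → Set
StrictlyMonotone f = ∀ i j → toℕ i < toℕ j → toℕ (f i) < toℕ (f j)

monotone-inflationary : (f : Fin n → Fin n) → StrictlyMonotone f → ∀ i → toℕ i ≤ toℕ (f i)
monotone-inflationary {n} f mono i = above (toℕ i) i refl
  where
  above : ∀ m (i : Fin n) → toℕ i ≡ m → m ≤ toℕ (f i)
  above zero    i _  = z≤n
  above (suc m) i eq = ≤-<-trans (above m j (toℕ-fromℕ< m<n)) (mono j i (subst (_< toℕ i) (sym (toℕ-fromℕ< m<n)) m<i))
    where
    m<i : m < toℕ i
    m<i = subst (m <_) (sym eq) ≤-refl
    m<n : m < n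
    m<n = <-trans m<i (toℕ<n i)
    j : Fin n
    j = fromℕ< m<n

-- A strictly monotone permutation of Fin n is the identity: both it and its
-- inverse lie above the identity.
monotone-identity : (σ : Perm n) → StrictlyMonotone (σ ⟨$⟩ʳ_) → ∀ i → σ ⟨$⟩ʳ i ≡ i
monotone-identity σ mono i = toℕ-injective (≤-antisym
  (subst (λ z → toℕ (σ ⟨$⟩ʳ i) ≤ toℕ z) (inverseˡ σ) (monotone-inflationary (σ ⟨$⟩ˡ_) mono⁻¹ (σ ⟨$⟩ʳ i)))
  (monotone-inflationary (σ ⟨$⟩ʳ_) mono i))
  where
  mono⁻¹ : StrictlyMonotone (σ ⟨$⟩ˡ_)
  mono⁻¹ a b a<b with toℕ (σ ⟨$⟩ˡ a) <? toℕ (σ ⟨$⟩ˡ b)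
  ... | yes lt = lt
  ... | no ≮ with m≤n⇒m<n∨m≡n (≮⇒≥ ≮)
  ...   | inj₁ gt = ⊥-elim (<-asym a<b (subst₂ (λ u v → toℕ u < toℕ v) (inverseʳ σ) (inverseʳ σ) (mono _ _ gt)))
  ...   | inj₂ eq = ⊥-elim (<-irrefl (cong toℕ (trans (sym (inverseʳ σ)) (trans (cong (σ ⟨$⟩ʳ_) (toℕ-injective (sym eq))) (inverseʳ σ)))) a<b)

containment-equal : (q q′ : LinOrd n) → (∀ x y → ordRel q x y → ordRel q′ x y) → q ≃ q′
containment-equal {n} q q′ q⊆q′ = mk≃ λ i → trans (sym (inverseʳ q′)) (cong (q′ ⟨$⟩ʳ_) (monotone-identity σ mono i))
  where
  -- σ maps the rank of an element in q to its rank in q′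
  σ : Perm n
  σ = q′ ⁻¹ · q
  mono : StrictlyMonotone (σ ⟨$⟩ʳ_)
  mono i j i<j = q⊆q′ (q ⟨$⟩ʳ i) (q ⟨$⟩ʳ j) (subst₂ (λ u v → toℕ u < toℕ v) (sym (inverseˡ q)) (sym (inverseˡ q)) i<j)

orderRel : LinOrd n → Relation n
orderRel q x y = isYes (pos q x <? pos q y)

orderRel-cong : ∀ {q q′ : LinOrd n} → q ≃ q′ → ∀ x y → orderRel q x y ≡ orderRel q′ x y
orderRel-cong e x y = cong₂′ (≃-inverse e x) (≃-inverse e y)
  where
  cong₂′ : ∀ {a a′ b b′} → a ≡ a′ → b ≡ b′ → isYes (toℕ a <? toℕ b) ≡ isYes (toℕ a′ <? toℕ b′)
  cong₂′ refl refl = refl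

orderRel-irreflexive : (q : LinOrd n) → IrreflexiveRel (orderRel q)
orderRel-irreflexive q x t = <-irrefl refl (toWitness t)

-- Ranks increase along chains, so the relation of an order is acyclic.
orderRel-acyclic : (q : LinOrd n) → AcyclicRel (orderRel q)
orderRel-acyclic q x ys z _ chain t = <-asym (increasing x ys z chain) (toWitness t)
  where
  increasing : ∀ x ys z → Linked (λ a b → (a , b) ∈R orderRel q) (x ∷ ys ++ [ z ]) → pos q x < pos q z
  increasing x []       z (t ∷ [-]) = toWitness t
  increasing x (y ∷ ys) z (t ∷ l)   = <-trans (toWitness t) (increasing y ys z l)

orderRel-equivariant : ∀ {h n} (g : G h n) (q : LinOrd n) x y →
  ((x , y) ∈R orderRel (actOrd g q)) ⇔ actRelSet (ψ g) (orderRel q) (ρ g) x y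
orderRel-equivariant ⟨ _ , ψ , ι ⟩ q x y = mk⇔
  (λ t → ψ ⟨$⟩ˡ x , ψ ⟨$⟩ˡ y , t , sym (inverseʳ ψ) , sym (inverseʳ ψ))
  (λ { (a , b , t , refl , refl) → fromWitness (subst₂ (λ u v → pos q u < pos q v) (sym (inverseˡ ψ)) (sym (inverseˡ ψ)) (toWitness t)) })
orderRel-equivariant ⟨ _ , ψ , ρ₀ ⟩ q x y = mk⇔
  (λ t → ψ ⟨$⟩ˡ y , ψ ⟨$⟩ˡ x , fromWitness (opposite-reflects-< _ _ (toWitness t)) , sym (inverseʳ ψ) , sym (inverseʳ ψ))
  (λ { (a , b , t , refl , refl) → fromWitness (subst₂ (λ u v → toℕ (opposite (q ⟨$⟩ˡ u)) < toℕ (opposite (q ⟨$⟩ˡ v)))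
         (sym (inverseˡ ψ)) (sym (inverseˡ ψ)) (opposite-antitone _ _ (toWitness t))) })

module Regularity {h n : ℕ} (U : G h n → Bool) (regular : Regular U) (p : Profile h n) where

  ψ* : Perm n
  ψ* = proj₁ (regular p)

  ψ*-involution : Involution ψ*
  ψ*-involution = conjugate-involution ψ* (proj₁ (proj₂ (regular p)))

  ψ*-fixed : AtMostOneFixedPoint ψ*
  ψ*-fixed = conjugate-fixed-unique ψ* (proj₁ (proj₂ (regular p)))

  stab-ι : ∀ g → InStab U p g → ρ g ≡ ι → ψ g ≈ₚ idP
  stab-ι g st ρ≡ι with proj₂ (proj₂ (regular p)) g st
  ... | inj₁ (ψ≈id , _) = ψ≈id
  ... | inj₂ (_ , ρ≡ρ₀) = contradiction (trans (sym ρ≡ι) ρ≡ρ₀) λ ()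

  stab-ρ₀ : ∀ g → InStab U p g → ρ g ≡ ρ₀ → ψ g ≈ₚ ψ*
  stab-ρ₀ g st ρ≡ρ₀ with proj₂ (proj₂ (regular p)) g st
  ... | inj₁ (_ , ρ≡ι) = contradiction (trans (sym ρ≡ρ₀) ρ≡ι) λ ()
  ... | inj₂ (ψ≈ψ* , _) = ψ≈ψ*

  stab-involution : ∀ g → InStab U p g → ρ g ≡ ρ₀ → Involution (ψ g)
  stab-involution g st ρ≡ρ₀ x = trans (ψ≈ψ* _) (trans (cong (ψ* ⟨$⟩ʳ_) (ψ≈ψ* x)) (ψ*-involution x))
    where
    ψ≈ψ* : ψ g ≈ₚ ψ*
    ψ≈ψ* = stab-ρ₀ g st ρ≡ρ₀

module Directions {h n : ℕ} (U : G h n → Bool) (U-subgroup : IsSubgroup U) (regular : Regular U)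
                  (C : SPC h n) (C-symmetric : USymmetricSPC U C) where

  -- (i) ⇒ (ii): let R(p) be the strict relation of the unique order in C′(p).
  -- Then C^R(p) = C′(p), since a linear order containing another equals it.
  resolute⇒method : Cond-i U C → Cond-ii U C
  resolute⇒method (C′ , resolute , C′-symmetric , C′-refines) = R , irreflexive , acyclic , R-symmetric , R-refines
    where
    chosen : Profile h n → LinOrd n
    chosen p = proj₁ (resolute p)

    chosen∈C′ : ∀ p → chosen p ∈C (p , C′)
    chosen∈C′ p = proj₁ (proj₂ (resolute p))

    only : ∀ p q → q ∈C (p , C′) → q ≃ chosen p
    only p q q∈C′ = mk≃ (proj₂ (proj₂ (resolute p)) q q∈C′)

    chosen-cong : ∀ {p p′} → p ≈P p′ → chosen p ≃ chosen p′
    chosen-cong {p} {p′} e = only p′ (chosen p) (SPC.resp C′ e (λ _ → refl) (chosen∈C′ p))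

    chosen-equivariant : ∀ p g → g ∈ᵤ U → chosen (act p g) ≃ actOrd g (chosen p)
    chosen-equivariant p g u = ≃-sym (only (act p g) (actOrd g (chosen p))
      (Equivalence.from (C′-symmetric p g u _) (chosen p , chosen∈C′ p , λ _ → refl)))

    R : SocialMethod h n
    R = record { rel = λ p → orderRel (chosen p) ; resp = λ e → orderRel-cong (chosen-cong e) }

    irreflexive : Irreflexive R
    irreflexive p = orderRel-irreflexive (chosen p)

    acyclic : Acyclic R
    acyclic p = orderRel-acyclic (chosen p)

    R-symmetric : USymmetricSM U R
    R-symmetric p g u x y = mk⇔
      (Equivalence.to (orderRel-equivariant g (chosen p) x y) ∘ subst T (same x y))
      (subst T (sym (same x y)) ∘ Equivalence.from (orderRel-equivariant g (chosen p) x y))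
      where
      same : ∀ x y → orderRel (chosen (act p g)) x y ≡ orderRel (actOrd g (chosen p)) x y
      same = orderRel-cong (chosen-equivariant p g u)

    R-refines : RefinesP (CR R) C
    R-refines p q R⊆q = SPC.resp C (λ _ _ → refl) (app (containment-equal (chosen p) q λ x y → R⊆q x y ∘ fromWitness))
      (C′-refines p (chosen p) (chosen∈C′ p))

  -- (ii) ⇒ (iii): for g = (φ′, ψ′, ρ₀) in Stab_U(p), U-symmetry gives
  -- R(p) = R(p^g) = ψ′ R(p)⁻¹, and ψ′ is an involution by regularity.
  method⇒reversal : Cond-ii U C → Cond-iii U C
  method⇒reversal (R , irreflexive , acyclic , R-symmetric , R-refines) = R , irreflexive , acyclic , R-refines , reverses
    where
    reverses : ∀ p x y φ′ ψ′ → InStab U p ⟨ φ′ , ψ′ , ρ₀ ⟩ →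
               ((x , y) ∈R rel R p) ⇔ ((ψ′ ⟨$⟩ʳ y , ψ′ ⟨$⟩ʳ x) ∈R rel R p)
    reverses p x y φ′ ψ′ st@(u , fixes) = mk⇔ to from
      where
      g : G h n
      g = ⟨ φ′ , ψ′ , ρ₀ ⟩
      open Regularity U regular p
      involution : Involution ψ′
      involution = stab-involution g st refl
      same : ∀ a b → rel R (act p g) a b ≡ rel R p a b
      same = SocialMethod.resp R fixes
      to : (x , y) ∈R rel R p → (ψ′ ⟨$⟩ʳ y , ψ′ ⟨$⟩ʳ x) ∈R rel R p
      to t with Equivalence.to (R-symmetric p g u x y) (subst T (sym (same x y)) t)
      ... | a , b , t′ , refl , refl = subst₂ (λ v w → T (rel R p v w)) (sym (involution a)) (sym (involution b)) t′
      from : (ψ′ ⟨$⟩ʳ y , ψ′ ⟨$⟩ʳ x) ∈R rel R p → (x , y) ∈R rel R p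
      from t = subst T (same x y)
        (Equivalence.from (R-symmetric p g u x y) (ψ′ ⟨$⟩ʳ y , ψ′ ⟨$⟩ʳ x , t , sym (involution y) , sym (involution x)))

  -- Each profile r gets a linear extension of R(r) fixed by
  -- Stab_U(r): a self-dual one with respect to ψ*(r) if the stabiliser has a
  -- reversing element (ρ = ρ₀), and any one otherwise, as elements with
  -- ρ = id act trivially.  Transported along orbits these give (i).
  module InvariantExtension (R : SocialMethod h n) (irreflexive : Irreflexive R) (acyclic : Acyclic R)
    (reverses : ∀ p x y φ′ ψ′ → InStab U p ⟨ φ′ , ψ′ , ρ₀ ⟩ →
                ((x , y) ∈R rel R p) ⇔ ((ψ′ ⟨$⟩ʳ y , ψ′ ⟨$⟩ʳ x) ∈R rel R p)) where
    open IsSubgroup U-subgroup renaming (resp to ∈U-resp)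

    Reversing : Profile h n → Set
    Reversing r = Σ (G h n) λ g → InStab U r g × ρ g ≡ ρ₀

    reversing? : ∀ r → Dec (Reversing r)
    reversing? r = decide-∃ (λ g → Any.map mk≅ (allG-enumerates h n g)) carries
      (λ g → (T? (U g) ×-dec map′ appP mk≋ (act r g ≋? r)) ×-dec is-ρ₀? (ρ g))
      where
      is-ρ₀? : ∀ a → Dec (a ≡ ρ₀)
      is-ρ₀? ι  = no λ ()
      is-ρ₀? ρ₀ = yes refl
      carries : ∀ {a b} → a ≅ b → InStab U r a × ρ a ≡ ρ₀ → InStab U r b × ρ b ≡ ρ₀
      carries e ((u , fixes) , reversing) =
        (∈U-resp (appG e) u , appP (≋-trans {p″ = r} (act-cong (≋-refl {p = r}) (≅-sym e)) (mk≋ fixes))) ,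
        trans (sym (proj₂ (proj₂ (appG e)))) reversing

    StabInvariant : Profile h n → LinOrd n → Set
    StabInvariant r q = ∀ g → g ∈ᵤ U → act r g ≋ r → actOrd g q ≃ q

    StableExtension : Profile h n → Set
    StableExtension r = Σ (LinOrd n) λ q → CR R r q × StabInvariant r q

    fixes-all : ∀ r q g → InStab U r g → ρ g ≡ ι → actOrd g q ≃ q
    fixes-all r q g st refl = mk≃ λ x → stab-ι g st refl (q ⟨$⟩ʳ x)
      where open Regularity U regular r

    self-dual-case : ∀ r → Reversing r → StableExtension r
    self-dual-case r (g₀@(⟨ φ₀ , ψ₀ , _ ⟩) , st₀ , refl) = q , extends , invariant
      where
      open Regularity U regular r
      anti : ∀ x y → (x , y) ∈R rel R r → (ψ* ⟨$⟩ʳ y , ψ* ⟨$⟩ʳ x) ∈R rel R r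
      anti x y t = subst₂ (λ v w → T (rel R r v w)) (stab-ρ₀ g₀ st₀ refl y) (stab-ρ₀ g₀ st₀ refl x)
                     (Equivalence.to (reverses r x y φ₀ ψ₀ st₀) t)
      open SelfDualExtension (rel R r) (irreflexive r) (acyclic r) ψ* ψ*-involution ψ*-fixed anti
      q : LinOrd n
      q = proj₁ self-dual-extension
      extends : CR R r q
      extends = proj₁ (proj₂ self-dual-extension)
      invariant : StabInvariant r q
      invariant g@(⟨ _ , _ , ι ⟩) u fixes = fixes-all r q g (u , appP fixes) refl
      invariant g@(⟨ _ , _ , ρ₀ ⟩) u fixes = mk≃ λ x →
        trans (stab-ρ₀ g (u , appP fixes) refl (q ⟨$⟩ʳ opposite x)) (proj₂ (proj₂ self-dual-extension) x)

    plain-case : ∀ r → ¬ Reversing r → StableExtension r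
    plain-case r none = q , proj₂ linear-extension , invariant
      where
      open LinearExtension (rel R r) (irreflexive r) (acyclic r)
      q : LinOrd n
      q = proj₁ linear-extension
      invariant : StabInvariant r q
      invariant g@(⟨ _ , _ , ι ⟩) u fixes = fixes-all r q g (u , appP fixes) refl
      invariant g@(⟨ _ , _ , ρ₀ ⟩) u fixes = contradiction (g , (u , appP fixes) , refl) none

    stable-extension : ∀ r → StableExtension r
    stable-extension r with reversing? r
    ... | yes reversing = self-dual-case r reversing
    ... | no none       = plain-case r none

    base : Profile h n → LinOrd n
    base r = proj₁ (stable-extension r)

  reversal⇒resolute : Cond-iii U C → Cond-i U C
  reversal⇒resolute (R , irreflexive , acyclic , R-refines , reverses) =
    extensionSPC , extensionSPC-resolute , extensionSPC-symmetric ,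
    extensionSPC-refines C C-symmetric (λ r → R-refines r (base r) (proj₁ (proj₂ (stable-extension r))))
    where
    open InvariantExtension R irreflexive acyclic reverses
    open EquivariantExtension U U-subgroup base (λ r → proj₂ (proj₂ (stable-extension r)))

theorem7 : ∀ (n h : ℕ) → 2 ≤ n → 2 ≤ h →
    (U : G h n → Bool) → IsSubgroup U → Regular U →
    (C : SPC h n) → Decisive C → USymmetricSPC U C →
    (Cond-i U C ⇔ Cond-ii U C) × (Cond-ii U C ⇔ Cond-iii U C)
theorem7 n h _ _ U U-subgroup regular C _ C-symmetric =
  mk⇔ resolute⇒method (reversal⇒resolute ∘ method⇒reversal) ,
  mk⇔ method⇒reversal (resolute⇒method ∘ reversal⇒resolute)
  where open Directions U U-subgroup regular C C-symmetric
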